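{- Let $n\ge 2$ and $G_n=C_{2^n}\times C_{2^n}$ with orbit tree $T_n$. For a node $N$ at level $n$ of $T_n$, let $P^+$ be the set of nodes on the path from $N$ to the root (including both $N$ and the root), let $P^-$ be the set of nodes $X$ of $T_n$ that are children of some node of $P^+$ but are not in $P^+$, and define $\chi_N$ on nodes $M$ of $T_n$ by $\chi_N(M)=|M|$ if $M\in P^+$, $\chi_N(M)=-|M|$ if $M\in P^-$, and $\chi_N(M)=0$ otherwise. Then for every character $\chi\in G_n^*$ of order $2^n$ (the highest possible order) there exists a unique node $N$ at level $n$ of $T_n$ such that $\chi(M)=\chi_N(M)$ for every node $M$ of $T_n$, where $\chi(M)=\sum_{g\in M}\chi(g)$.
   Context: $C_m=\{x/m: x\in\{0,\dots,m-1\}\}$ under addition mod $1$, and $G_n=C_{2^n}\times C_{2^n}$, with dual group $G_n^*$ of complex characters. The multiplier group $U(2^n)=\{u: u \text{ odd}, 1\le u\le 2^n\}$ acts on $G_n$ by $g\mapsto u\cdot g$. The orbit tree $T_n$ is the rooted tree whose nodes are the orbits of $G_n$ under this action: the root is $\{(0,0)\}$, the nodes at level $i$ are the orbits consisting of elements of order $2^i$ ($0\le i\le n$), and the parent of a node $M$ at level $i+1$ is the orbit containing $2x$ for any $x\in M$; the children of a node are the nodes whose parent it is. -}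

module Defs where

open import Data.Nat using (ℕ; zero; suc; _+_; _*_; _^_; _∸_; _≤_; _<_; NonZero; _≡ᵇ_)
open import Data.Nat.Properties using (m^n≢0)
open import Data.Nat.DivMod using (_mod_; _%_)
open import Data.Bool using (Bool; true; false; if_then_else_)
open import Data.Fin using (Fin; toℕ)
import Data.Fin.Properties as FinP
open import Data.Product using (Σ; _×_; _,_; proj₁; proj₂)
open import Data.List using (List; []; _∷_; map; length; filter; upTo; allFin; cartesianProduct; deduplicate; foldr)
open import Data.Integer as ℤ using (ℤ; +_; -_)
open import Relation.Binary.PropositionalEquality using (_≡_; _≢_; refl)
open import Relation.Binary.Definitions using (DecidableEquality)
open import Relation.Nullary using (¬_; yes; no)
open import Relation.Nullary.Decidable using (does)

-- The modulus 2^n and the group G_n = C_{2^n} × C_{2^n}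
-- C_m is modelled as Z/m (x/m ↦ x), i.e. Fin (2^n) with arithmetic mod 2^n.

reduce : (n k : ℕ) → Fin (2 ^ n)
reduce n k = _mod_ k (2 ^ n) {{m^n≢0 2 n}}

remP : (n k : ℕ) → ℕ
remP n k = _%_ k (2 ^ n) {{m^n≢0 2 n}}

Zmod : ℕ → Set
Zmod n = Fin (2 ^ n)

record G (n : ℕ) : Set where
  constructor ⟨_,_⟩
  field
    gx : Zmod n
    gy : Zmod n
open G public

_≟G_ : ∀ {n} → DecidableEquality (G n)
⟨ a , b ⟩ ≟G ⟨ c , d ⟩ with FinP._≟_ a c | FinP._≟_ b d
... | yes refl | yes refl = yes refl
... | no a≢c | _ = no λ { refl → a≢c refl }
... | yes _ | no b≢d = no λ { refl → b≢d refl }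

zeroG : ∀ n → G n
zeroG n = ⟨ reduce n 0 , reduce n 0 ⟩

addZ : ∀ n → Zmod n → Zmod n → Zmod n
addZ n a b = reduce n (toℕ a + toℕ b)

addG : ∀ {n} → G n → G n → G n
addG {n} ⟨ a , b ⟩ ⟨ c , d ⟩ = ⟨ addZ n a c , addZ n b d ⟩

scale : ∀ {n} → ℕ → G n → G n
scale {n} u ⟨ x , y ⟩ = ⟨ reduce n (u * toℕ x) , reduce n (u * toℕ y) ⟩

allG : ∀ n → List (G n)
allG n = map (λ p → ⟨ proj₁ p , proj₂ p ⟩) (cartesianProduct (allFin (2 ^ n)) (allFin (2 ^ n)))

IsOrder : ∀ {n} → G n → ℕ → Set
IsOrder {n} g k = (1 ≤ k) × (scale k g ≡ zeroG n)
                × ((j : ℕ) → 1 ≤ j → j < k → scale j g ≢ zeroG n)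

-- The multiplier group U(2^n) and orbits (= nodes of the orbit tree T_n)

Odd : ℕ → Set
Odd u = u % 2 ≡ 1

-- U(2^n) = odd u with 1 ≤ u ≤ 2^n (listed as the odd u in [0, 2^n), the same residues)
units : ℕ → List ℕ
units n = filter (λ u → (u % 2) Data.Nat.≟ 1) (upTo (2 ^ n))

SameOrbit : ∀ {n} → G n → G n → Set
SameOrbit {n} g h = Σ ℕ λ u → Odd u × (u < 2 ^ n) × (scale u g ≡ h)

orbit : ∀ {n} → G n → List (G n)
orbit {n} g = deduplicate _≟G_ (map (λ u → scale u g) (units n))

orbitSize : ∀ {n} → G n → ℕ
orbitSize g = length (orbit g)

-- Characters.  Every complex character of G_n takes values in the
-- 2^n-th roots of unity; we write χ(g) = ζ^{e(g)} with ζ = exp(2πi/2^n)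
-- and e : G_n → Z/2^n a group homomorphism.

record Character (n : ℕ) : Set where
  field
    expo : G n → Zmod n
    hom  : ∀ g h → expo (addG g h) ≡ addZ n (expo g) (expo h)
open Character public

-- χ^k is trivial iff k · e(g) ≡ 0 mod 2^n for all g
CharPowTrivial : ∀ {n} → Character n → ℕ → Set
CharPowTrivial {n} χ k = ∀ g → remP n (k * toℕ (expo χ g)) ≡ 0

IsCharOrder : ∀ {n} → Character n → ℕ → Set
IsCharOrder χ k = (1 ≤ k) × CharPowTrivial χ k
                × ((j : ℕ) → 1 ≤ j → j < k → ¬ CharPowTrivial χ j)

-- Exact arithmetic in Z[ζ] ⊂ ℂ, ζ = exp(2πi/2^n), n ≥ 1.
-- Z[ζ] ≅ Z[x]/(x^h + 1) with h = 2^(n-1), with Z-basis 1, ζ, …, ζ^(h-1).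
-- An element is represented by its coefficient function j ↦ coeff of ζ^j
-- (only j < h is meaningful).

Cyc : Set
Cyc = ℕ → ℤ

half : ℕ → ℕ
half n = 2 ^ (n ∸ 1)

-- ζ^k for 0 ≤ k < 2^n : equals ζ^k if k < h, and −ζ^(k−h) otherwise
zetaPow : ℕ → ℕ → Cyc
zetaPow n k j = if k ≡ᵇ j then + 1 else (if k ≡ᵇ (j + half n) then - (+ 1) else + 0)

cycAdd : Cyc → Cyc → Cyc
cycAdd a b j = a j ℤ.+ b j

cycZero : Cyc
cycZero _ = + 0

CycIsInt : ℕ → Cyc → ℤ → Set
CycIsInt n a c = (j : ℕ) → j < half n → a j ≡ (if j ≡ᵇ 0 then c else + 0)

charOnOrbit : ∀ {n} → Character n → G n → Cyc
charOnOrbit {n} χ m = foldr (λ g acc → cycAdd (zetaPow n (toℕ (expo χ g))) acc) cycZero (orbit m)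

-- the orbit of m lies on the path from orbit(gN) to the root,
-- i.e. equals the orbit of 2^j · gN for some 0 ≤ j ≤ n
InPplus : ∀ {n} → G n → G n → Set
InPplus {n} gN m = Σ ℕ λ j → (j ≤ n) × SameOrbit (scale (2 ^ j) gN) m

-- the orbit of m is a child (non-root node whose parent is orbit(2m))
-- of a node of P⁺ but is not itself in P⁺
InPminus : ∀ {n} → G n → G n → Set
InPminus {n} gN m = (m ≢ zeroG n) × InPplus gN (scale 2 m) × ¬ InPplus gN m

AgreesWithChiN : ∀ {n} → Character n → G n → Set
AgreesWithChiN {n} χ gN = (m : G n) →
    (InPplus gN m → CycIsInt n (charOnOrbit χ m) (+ orbitSize m))
  × (InPminus gN m → CycIsInt n (charOnOrbit χ m) (- (+ orbitSize m)))
  × (¬ InPplus gN m → ¬ InPminus gN m → CycIsInt n (charOnOrbit χ m) (+ 0))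

-- A character of G_n is g ↦ ζ^e(g) with e(x, y) = x a + y b a homomorphism to Z/2^n; it has
-- order 2^n iff a or b is odd, and then ker e is cyclic, generated by some g_N of order 2^n.
-- The orbits in P⁺ are exactly those inside ker e and the orbits in P⁻ those on which
-- e = 2^(n-1), so χ is constantly 1, resp. −1, on them.  On any other orbit e has 2-adic
-- valuation s < n - 1, and the odd multiplier 1 + 2^(n-1-s) permutes the orbit while adding
-- 2^(n-1) to e, i.e. negating χ; so χ sums to 0 there.  Conversely, if χ agrees with χ_N',
-- then the orbit N' itself must get the value |N'| (and not −|N'| or 0), forcing N' ⊆ ker e;
-- thus N' = t·g_N with t odd by the order condition.

module Submission where

open import Defs
import Data.Nat as ℕ
open import Data.Nat using (ℕ; zero; suc; _+_; _*_; _∸_; _^_; _≤_; _<_; _>_; _≡ᵇ_; z≤n; s≤s; z<s; NonZero; >-nonZero⁻¹)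
open import Data.Nat.Properties
open import Data.Nat.DivMod
open import Data.Nat.Divisibility using (_∣_; n∣m⇒m%n≡0; ∣⇒≤; 0∣⇒≡0; ∣1⇒≡1; m∣m*n; ∣-trans)
open import Data.Nat.Coprimality using (Coprime; coprime-factors; coprime-Bézout) renaming (sym to coprime-sym)
open import Data.Nat.GCD using (module Bézout)
open import Data.Nat.Solver using (module +-*-Solver)
open import Data.Fin using (toℕ)
import Data.Fin.Properties as FinP
open import Data.Product using (Σ; ∃; _×_; _,_; proj₁; proj₂)
open import Data.Sum using (_⊎_; inj₁; inj₂)
open import Data.Empty using (⊥-elim)
open import Data.Bool using (true; false)
open import Data.Bool.Properties using (if-eta)
open import Function using (_∘_)
open import Level using (0ℓ)
open import Relation.Nullary using (¬_; yes; no)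
open import Relation.Nullary.Decidable using (dec-true; dec-false)
open import Relation.Binary.Bundles using (Setoid)
import Relation.Binary.Reasoning.Setoid as SetoidReasoning
open import Relation.Binary.PropositionalEquality
open import Data.Integer using (ℤ; +_; -_) renaming (_+_ to _+ℤ_; _*_ to _*ℤ_)
import Data.Integer.Properties as ZP
open import Data.List using (List; []; _∷_; map; length; foldr; upTo)
open import Data.List.Properties using (length-map; map-∘; map-cong-local)
open import Data.List.Relation.Unary.All as All using (All; []; _∷_)
import Data.List.Relation.Unary.All.Properties as AllP
open import Data.List.Membership.Propositional using (_∈_)
open import Data.List.Membership.Propositional.Properties using (∈-map⁺; ∈-map⁻; ∈-filter⁺; ∈-filter⁻; ∈-upTo⁺; ∈-upTo⁻; ∈-deduplicate⁺; ∈-deduplicate⁻)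
open import Data.List.Membership.Propositional.Properties.WithK using (unique∧set⇒bag)
open import Data.List.Relation.Binary.BagAndSetEquality using (∼bag⇒↭)
open import Data.List.Relation.Binary.Permutation.Propositional using (_↭_; ↭⇒↭ₛ)
import Data.List.Relation.Binary.Permutation.Setoid.Properties as PermSetoid
import Data.List.Relation.Binary.Permutation.Propositional.Properties as PermP
open import Data.List.Relation.Unary.Unique.Propositional using (Unique)
import Data.List.Relation.Unary.Unique.Propositional.Properties as UniqueP
import Data.List.Relation.Unary.Unique.DecPropositional.Properties as UniqueDecP
open import Function.Bundles using (mk⇔)
open +-*-Solver

module Congruence (M : ℕ) .{{_ : NonZero M}} where

  -- A record, so that a and b can be recovered from a proof of a ≈ b.
  infix 4 _≈_
  record _≈_ (a b : ℕ) : Set where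
    constructor mk≈
    field %-≡ : a % M ≡ b % M

  ≈-refl : ∀ {a} → a ≈ a
  ≈-refl = mk≈ refl

  ≈-sym : ∀ {a b} → a ≈ b → b ≈ a
  ≈-sym (mk≈ p) = mk≈ (sym p)

  ≈-trans : ∀ {a b c} → a ≈ b → b ≈ c → a ≈ c
  ≈-trans (mk≈ p) (mk≈ q) = mk≈ (trans p q)

  ≈-setoid : Setoid 0ℓ 0ℓ
  ≈-setoid = record
    { Carrier = ℕ ; _≈_ = _≈_
    ; isEquivalence = record { refl = ≈-refl ; sym = ≈-sym ; trans = ≈-trans } }

  module ≈-Reasoning = SetoidReasoning ≈-setoid

  ≡⇒≈ : ∀ {a b} → a ≡ b → a ≈ b
  ≡⇒≈ p = mk≈ (cong (_% M) p)

  %-≈ : ∀ a → a % M ≈ a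
  %-≈ a = mk≈ (m%n%n≡m%n a M)

  +-cong : ∀ {a b c d} → a ≈ b → c ≈ d → a + c ≈ b + d
  +-cong {a} {b} {c} {d} (mk≈ p) (mk≈ q) = mk≈ (trans (%-distribˡ-+ a c M)
    (trans (cong₂ (λ x y → (x + y) % M) p q) (sym (%-distribˡ-+ b d M))))

  *-cong : ∀ {a b c d} → a ≈ b → c ≈ d → a * c ≈ b * d
  *-cong {a} {b} {c} {d} (mk≈ p) (mk≈ q) = mk≈ (trans (%-distribˡ-* a c M)
    (trans (cong₂ (λ x y → (x * y) % M) p q) (sym (%-distribˡ-* b d M))))

  +-congˡ : ∀ c {a b} → a ≈ b → c + a ≈ c + b
  +-congˡ c = +-cong (≈-refl {c})

  *-congˡ : ∀ c {a b} → a ≈ b → c * a ≈ c * b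
  *-congˡ c = *-cong (≈-refl {c})

  *-congʳ : ∀ c {a b} → a ≈ b → a * c ≈ b * c
  *-congʳ c p = *-cong p (≈-refl {c})

  0%M≡0 : 0 % M ≡ 0
  0%M≡0 = m<n⇒m%n≡m (>-nonZero⁻¹ M)

  ≈0⇒%≡0 : ∀ {a} → a ≈ 0 → a % M ≡ 0
  ≈0⇒%≡0 (mk≈ p) = trans p 0%M≡0

  %≡0⇒≈0 : ∀ {a} → a % M ≡ 0 → a ≈ 0
  %≡0⇒≈0 p = mk≈ (trans p (sym 0%M≡0))

  m*M≈0 : ∀ t → t * M ≈ 0
  m*M≈0 t = %≡0⇒≈0 (m*n%n≡0 t M)

  M≈0 : M ≈ 0
  M≈0 = %≡0⇒≈0 (n%n≡0 M)

  ≈⇒≡ : ∀ {a b} → a < M → b < M → a ≈ b → a ≡ b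
  ≈⇒≡ {a} {b} a<M b<M (mk≈ p) = trans (sym (m<n⇒m%n≡m a<M)) (trans p (m<n⇒m%n≡m b<M))

  negate : ℕ → ℕ
  negate a = M ∸ a % M

  +-negate≈0 : ∀ a → a + negate a ≈ 0
  +-negate≈0 a = ≈-trans (+-cong (≈-sym (%-≈ a)) ≈-refl)
                         (≈-trans (≡⇒≈ (m+[n∸m]≡n (m%n≤n a M))) M≈0)

  +-cancelˡ-≈ : ∀ a {b c} → a + b ≈ a + c → b ≈ c
  +-cancelˡ-≈ a {b} {c} p = begin
    b              ≡⟨ +-identityʳ b ⟨
    b + 0          ≈⟨ +-congˡ b (+-negate≈0 a) ⟨
    b + (a + ā)    ≡⟨ solve 3 (λ a b ā → b :+ (a :+ ā) := (a :+ b) :+ ā) refl a b ā ⟩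
    (a + b) + ā    ≈⟨ +-cong p ≈-refl ⟩
    (a + c) + ā    ≡⟨ solve 3 (λ a c ā → (a :+ c) :+ ā := c :+ (a :+ ā)) refl a c ā ⟩
    c + (a + ā)    ≈⟨ +-congˡ c (+-negate≈0 a) ⟩
    c + 0          ≡⟨ +-identityʳ c ⟩
    c              ∎
    where open ≈-Reasoning
          ā = negate a

  coprime⇒invertible : ∀ {a} → Coprime a M → ∃ λ a' → a * a' ≈ 1
  coprime⇒invertible {a} a⊥M with coprime-Bézout a⊥M
  ... | Bézout.+- x y eq = x , (begin
    a * x       ≡⟨ trans (*-comm a x) (sym eq) ⟩
    1 + y * M   ≈⟨ +-congˡ 1 (m*M≈0 y) ⟩
    1 + 0       ∎)
    where open ≈-Reasoning
  ... | Bézout.-+ x y eq = M-1 * x , +-cancelˡ-≈ M-1 (begin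
    M-1 + a * (M-1 * x)   ≡⟨ solve 3 (λ m a x → m :+ a :* (m :* x) := m :* (con 1 :+ x :* a)) refl M-1 a x ⟩
    M-1 * (1 + x * a)     ≡⟨ cong (M-1 *_) eq ⟩
    M-1 * (y * M)         ≈⟨ *-congˡ M-1 (m*M≈0 y) ⟩
    M-1 * 0               ≡⟨ *-zeroʳ M-1 ⟩
    0                     ≈⟨ M≈0 ⟨
    M                     ≡⟨ m∸n+n≡m (>-nonZero⁻¹ M) ⟨
    M-1 + 1               ∎)
    where open ≈-Reasoning
          M-1 = M ∸ 1

parity : ∀ u → u % 2 ≡ 0 ⊎ Odd u
parity u with u % 2 | m%n<n u 2
... | 0 | _ = inj₁ refl
... | 1 | _ = inj₂ refl
... | suc (suc _) | s≤s (s≤s ())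

even⇒≡[/2]*2 : ∀ {u} → u % 2 ≡ 0 → u ≡ u / 2 * 2
even⇒≡[/2]*2 {u} e = trans (m≡m%n+[m/n]*n u 2) (cong (_+ u / 2 * 2) e)

odd⇒≡1+[/2]*2 : ∀ {u} → Odd u → u ≡ 1 + u / 2 * 2
odd⇒≡1+[/2]*2 {u} o = trans (m≡m%n+[m/n]*n u 2) (cong (_+ u / 2 * 2) o)

odd-1+2* : ∀ q → Odd (1 + q * 2)
odd-1+2* q = [m+kn]%n≡m%n 1 q 2

odd-* : ∀ {u w} → Odd u → Odd w → Odd (u * w)
odd-* {u} {w} ou ow = trans (%-distribˡ-* u w 2) (cong₂ (λ x y → (x * y) % 2) ou ow)

odd-% : ∀ {u} M .{{_ : NonZero M}} → 2 ∣ M → Odd u → Odd (u % M)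
odd-% {u} M 2∣M ou = trans (m∣n⇒o%n%m≡o%m 2 M u 2∣M) ou

odd⇒coprime-2 : ∀ {a} → Odd a → Coprime 2 a
odd⇒coprime-2 {a} oa {d} (d∣2 , d∣a) with ∣⇒≤ d∣2
... | z≤n = ⊥-elim (2≢0 (0∣⇒≡0 d∣2))
  where 2≢0 : 2 ≢ 0
        2≢0 ()
... | s≤s z≤n = refl
... | s≤s (s≤s z≤n) = ⊥-elim (0≢1 (trans (sym (n∣m⇒m%n≡0 a 2 d∣a)) oa))
  where 0≢1 : 0 ≢ 1
        0≢1 ()

odd⇒coprime-2^ : ∀ {a} → Odd a → ∀ t → Coprime (2 ^ t) a
odd⇒coprime-2^ oa zero (d∣1 , _) = ∣1⇒≡1 d∣1
odd⇒coprime-2^ {a} oa (suc t) (d∣2^[1+t] , d∣a) = odd⇒coprime-2^ oa t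
  (coprime-factors {2} {a} (odd⇒coprime-2 oa) (d∣2^[1+t] , ∣-trans d∣a (m∣m*n (2 ^ t))) , d∣a)

odd-part : ∀ f c → c ≢ 0 → c < 2 ^ f → Σ ℕ λ s → Σ ℕ λ w → s < f × Odd w × c ≡ 2 ^ s * w
odd-part zero zero c≢0 _ = ⊥-elim (c≢0 refl)
odd-part zero (suc c) _ (s≤s ())
odd-part (suc f) c c≢0 c<2^[1+f] with parity c
... | inj₂ oc = 0 , c , z<s , oc , sym (+-identityʳ c)
... | inj₁ ec with odd-part f (c / 2) c/2≢0 c/2<2^f
  where
    c/2≢0 : c / 2 ≢ 0
    c/2≢0 c/2≡0 = c≢0 (trans (even⇒≡[/2]*2 ec) (cong (_* 2) c/2≡0))
    c/2<2^f : c / 2 < 2 ^ f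
    c/2<2^f = *-cancelʳ-< 2 (c / 2) (2 ^ f)
      (subst₂ _<_ (even⇒≡[/2]*2 ec) (*-comm 2 (2 ^ f)) c<2^[1+f])
... | s , w , s<f , ow , c/2≡ = suc s , w , s≤s s<f , ow , (begin
  c                 ≡⟨ even⇒≡[/2]*2 ec ⟩
  c / 2 * 2         ≡⟨ cong (_* 2) c/2≡ ⟩
  2 ^ s * w * 2     ≡⟨ solve 2 (λ p w → p :* w :* con 2 := (con 2 :* p) :* w) refl (2 ^ s) w ⟩
  2 ^ suc s * w     ∎)
  where open ≡-Reasoning

sumℤ : List ℤ → ℤ
sumℤ = foldr _+ℤ_ (+ 0)

sumℤ-↭ : ∀ {xs ys} → xs ↭ ys → sumℤ xs ≡ sumℤ ys
sumℤ-↭ p = PermSetoid.foldr-commMonoid (setoid ℤ) ZP.+-0-isCommutativeMonoid (↭⇒↭ₛ p)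

sumℤ-map-neg : ∀ zs → sumℤ (map -_ zs) ≡ - sumℤ zs
sumℤ-map-neg [] = refl
sumℤ-map-neg (z ∷ zs) = trans (cong (- z +ℤ_) (sumℤ-map-neg zs)) (sym (ZP.neg-distrib-+ z (sumℤ zs)))

sumℤ-const : ∀ {c zs} → All (_≡ c) zs → sumℤ zs ≡ + length zs *ℤ c
sumℤ-const [] = refl
sumℤ-const {c} {_ ∷ zs} (refl ∷ ps) = trans (cong (c +ℤ_) (sumℤ-const ps)) (sym (ZP.suc-* (+ length zs) c))

≡-neg⇒≡0 : ∀ {z} → z ≡ - z → z ≡ + 0
≡-neg⇒≡0 {+ zero} _ = refl

cycSum-at : ∀ {A : Set} (F : A → Cyc) xs j →
  foldr (λ x acc → cycAdd (F x) acc) cycZero xs j ≡ sumℤ (map (λ x → F x j) xs)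
cycSum-at F [] j = refl
cycSum-at F (x ∷ xs) j = cong (F x j +ℤ_) (cycSum-at F xs j)

map-bijection-↭ : ∀ {A : Set} {xs : List A} {φ ψ : A → A} → Unique xs →
  (∀ {x} → x ∈ xs → φ x ∈ xs) → (∀ {x} → x ∈ xs → ψ x ∈ xs) →
  (∀ x → φ (ψ x) ≡ x) → (∀ x → ψ (φ x) ≡ x) → xs ↭ map φ xs
map-bijection-↭ {xs = xs} {φ} {ψ} !xs φ∈ ψ∈ φψ ψφ =
  ∼bag⇒↭ (unique∧set⇒bag !xs (UniqueP.map⁺ φ-injective !xs) (mk⇔ to from))
  where
    φ-injective : ∀ {x y} → φ x ≡ φ y → x ≡ y
    φ-injective {x} {y} eq = trans (sym (ψφ x)) (trans (cong ψ eq) (ψφ y))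
    to : ∀ {x} → x ∈ xs → x ∈ map φ xs
    to {x} x∈ = subst (_∈ map φ xs) (φψ x) (∈-map⁺ φ (ψ∈ x∈))
    from : ∀ {x} → x ∈ map φ xs → x ∈ xs
    from x∈ with ∈-map⁻ φ x∈
    ... | y , y∈ , refl = φ∈ y∈

module Group (n : ℕ) where

  M : ℕ
  M = 2 ^ n

  instance
    M≢0 : NonZero M
    M≢0 = m^n≢0 2 n

  open Congruence M public

  odd⇒invertible : ∀ {a} → Odd a → ∃ λ a' → a * a' ≈ 1
  odd⇒invertible {a} oa = coprime⇒invertible (coprime-sym (odd⇒coprime-2^ {a} oa n))

  X Y : G n → ℕ
  X g = toℕ (gx g)
  Y g = toℕ (gy g)

  toℕ-reduce : ∀ a → toℕ (reduce n a) ≈ a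
  toℕ-reduce a = ≈-trans (≡⇒≈ (FinP.toℕ-fromℕ< _)) (%-≈ a)

  ≈⇒≡-Zmod : ∀ {a b : Zmod n} → toℕ a ≈ toℕ b → a ≡ b
  ≈⇒≡-Zmod p = FinP.toℕ-injective (≈⇒≡ (FinP.toℕ<n _) (FinP.toℕ<n _) p)

  G-ext : ∀ {g g' : G n} → X g ≈ X g' → Y g ≈ Y g' → g ≡ g'
  G-ext p q = cong₂ ⟨_,_⟩ (≈⇒≡-Zmod p) (≈⇒≡-Zmod q)

  scale-suc : ∀ u g → scale (suc u) g ≡ addG g (scale u g)
  scale-suc u g = G-ext (coord (X g)) (coord (Y g))
    where
      coord : ∀ c → toℕ (reduce n (suc u * c)) ≈ toℕ (reduce n (c + toℕ (reduce n (u * c))))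
      coord c = ≈-trans (toℕ-reduce _) (≈-sym (≈-trans (toℕ-reduce _) (+-congˡ c (toℕ-reduce _))))

  scale-* : ∀ u w g → scale u (scale w g) ≡ scale (u * w) g
  scale-* u w g = G-ext (coord (X g)) (coord (Y g))
    where
      coord : ∀ c → toℕ (reduce n (u * toℕ (reduce n (w * c)))) ≈ toℕ (reduce n (u * w * c))
      coord c = ≈-trans (toℕ-reduce _) (≈-trans (*-congˡ u (toℕ-reduce _))
                  (≈-trans (≡⇒≈ (sym (*-assoc u w c))) (≈-sym (toℕ-reduce _))))

  scale-% : ∀ u g → scale (u % M) g ≡ scale u g
  scale-% u g = G-ext (coord (X g)) (coord (Y g))
    where
      coord : ∀ c → toℕ (reduce n (u % M * c)) ≈ toℕ (reduce n (u * c))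
      coord c = ≈-trans (toℕ-reduce _) (≈-trans (*-congʳ c (%-≈ u)) (≈-sym (toℕ-reduce _)))

  scale-1 : ∀ g → scale 1 g ≡ g
  scale-1 g = G-ext (coord (X g)) (coord (Y g))
    where
      coord : ∀ c → toℕ (reduce n (1 * c)) ≈ c
      coord c = ≈-trans (toℕ-reduce _) (≡⇒≈ (*-identityˡ c))

  scale-*M : ∀ t g → scale (t * M) g ≡ zeroG n
  scale-*M t g = G-ext (coord (X g)) (coord (Y g))
    where
      coord : ∀ c → toℕ (reduce n (t * M * c)) ≈ toℕ (reduce n 0)
      coord c = ≈-trans (toℕ-reduce _) (≈-trans (≡⇒≈ (solve 3 (λ t m c → t :* m :* c := t :* c :* m) refl t M c))
                  (≈-trans (m*M≈0 (t * c)) (≈-sym (toℕ-reduce 0))))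

  scale-M : ∀ g → scale M g ≡ zeroG n
  scale-M g = trans (cong (λ t → scale t g) (sym (*-identityˡ M))) (scale-*M 1 g)

  scale-inverse : ∀ {u w} → u * w ≈ 1 → ∀ g → scale u (scale w g) ≡ g
  scale-inverse {u} {w} (mk≈ uw≈1) g = begin
    scale u (scale w g)     ≡⟨ scale-* u w g ⟩
    scale (u * w) g         ≡⟨ scale-% (u * w) g ⟨
    scale (u * w % M) g     ≡⟨ cong (λ t → scale t g) uw≈1 ⟩
    scale (1 % M) g         ≡⟨ scale-% 1 g ⟩
    scale 1 g               ≡⟨ scale-1 g ⟩
    g                       ∎
    where open ≡-Reasoning

  zeroG+zeroG : addG (zeroG n) (zeroG n) ≡ zeroG n
  zeroG+zeroG = G-ext coord coord
    where
      coord : toℕ (reduce n (toℕ (reduce n 0) + toℕ (reduce n 0))) ≈ toℕ (reduce n 0)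
      coord = ≈-trans (toℕ-reduce _) (≈-trans (+-cong (toℕ-reduce 0) (toℕ-reduce 0)) (≈-sym (toℕ-reduce 0)))

  e₁ e₂ : G n
  e₁ = ⟨ reduce n 1 , reduce n 0 ⟩
  e₂ = ⟨ reduce n 0 , reduce n 1 ⟩

  decompose : ∀ g → g ≡ addG (scale (X g) e₁) (scale (Y g) e₂)
  decompose g = G-ext (≈-sym (coord (X g) (Y g) (X g) (solve 2 (λ x y → x :* con 1 :+ y :* con 0 := x) refl (X g) (Y g))))
                      (≈-sym (coord (X g) (Y g) (Y g) (solve 2 (λ x y → x :* con 0 :+ y :* con 1 := y) refl (X g) (Y g))))
    where
      coord : ∀ x y c {i j} → x * i + y * j ≡ c →
        toℕ (reduce n (toℕ (reduce n (x * toℕ (reduce n i))) + toℕ (reduce n (y * toℕ (reduce n j))))) ≈ c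
      coord x y c {i} {j} eq = ≈-trans (toℕ-reduce _) (≈-trans (+-cong (toℕ-reduce _) (toℕ-reduce _))
        (≈-trans (+-cong (*-congˡ x (toℕ-reduce i)) (*-congˡ y (toℕ-reduce j))) (≡⇒≈ eq)))

  E : Character n → G n → ℕ
  E χ g = toℕ (expo χ g)

  E<M : ∀ χ g → E χ g < M
  E<M χ g = FinP.toℕ<n (expo χ g)

  E-add : ∀ χ g g' → E χ (addG g g') ≈ E χ g + E χ g'
  E-add χ g g' = ≈-trans (≡⇒≈ (cong toℕ (hom χ g g'))) (toℕ-reduce _)

  E-zero : ∀ χ → E χ (zeroG n) ≡ 0
  E-zero χ = ≈⇒≡ (E<M χ 0G) (>-nonZero⁻¹ M) (≈-sym (+-cancelˡ-≈ e (begin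
    e + 0          ≡⟨ +-identityʳ e ⟩
    e              ≡⟨ cong (E χ) zeroG+zeroG ⟨
    E χ (addG 0G 0G) ≈⟨ E-add χ 0G 0G ⟩
    e + e          ∎)))
    where open ≈-Reasoning
          0G = zeroG n
          e = E χ 0G

  E-scale : ∀ χ u g → E χ (scale u g) ≈ u * E χ g
  E-scale χ zero g = ≡⇒≈ (E-zero χ)
  E-scale χ (suc u) g = ≈-trans (≡⇒≈ (cong (E χ) (scale-suc u g)))
    (≈-trans (E-add χ g (scale u g)) (+-congˡ (E χ g) (E-scale χ u g)))

  E-linear : ∀ χ g → E χ g ≈ X g * E χ e₁ + Y g * E χ e₂
  E-linear χ g = ≈-trans (≡⇒≈ (cong (E χ) (decompose g)))
    (≈-trans (E-add χ _ _) (+-cong (E-scale χ (X g) e₁) (E-scale χ (Y g) e₂)))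

  record CyclicKernel (χ : Character n) : Set where
    field
      generator : G n
      E-generator : E χ generator ≡ 0
      generator-order : IsOrder generator M
      kernel⊆multiples : ∀ m → E χ m ≡ 0 → ∃ λ t → t < M × scale t generator ≡ m

  -- For a = E χ e₁ invertible, the kernel of x a + y b is generated by (− a⁻¹ b, 1).
  cyclicKernel-e₁ : ∀ χ → Odd (E χ e₁) → CyclicKernel χ
  cyclicKernel-e₁ χ oa = record
    { generator = g₀ ; E-generator = E-g₀ ; generator-order = order-g₀ ; kernel⊆multiples = kernel⊆ }
    where
      a = E χ e₁
      b = E χ e₂
      a⁻¹ = proj₁ (odd⇒invertible {a} oa)
      aa⁻¹≈1 : a * a⁻¹ ≈ 1
      aa⁻¹≈1 = proj₂ (odd⇒invertible {a} oa)
      c = negate (a⁻¹ * b)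
      g₀ : G n
      g₀ = ⟨ reduce n c , reduce n 1 ⟩
      E-g₀ : E χ g₀ ≡ 0
      E-g₀ = ≈⇒≡ (E<M χ g₀) (>-nonZero⁻¹ M) (begin
        E χ g₀                   ≈⟨ E-linear χ g₀ ⟩
        X g₀ * a + Y g₀ * b      ≈⟨ +-cong (*-congʳ a (toℕ-reduce c)) (*-congʳ b (toℕ-reduce 1)) ⟩
        c * a + 1 * b            ≈⟨ +-congˡ (c * a) (*-congʳ b aa⁻¹≈1) ⟨
        c * a + a * a⁻¹ * b      ≡⟨ solve 4 (λ c a a' b → c :* a :+ a :* a' :* b := a :* (a' :* b :+ c)) refl c a a⁻¹ b ⟩
        a * (a⁻¹ * b + c)        ≈⟨ *-congˡ a (+-negate≈0 (a⁻¹ * b)) ⟩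
        a * 0                    ≡⟨ *-zeroʳ a ⟩
        0                        ∎)
        where open ≈-Reasoning
      order-g₀ : IsOrder g₀ M
      order-g₀ = >-nonZero⁻¹ M , scale-M g₀ , λ j 1≤j j<M j·g₀≡0 →
        <⇒≢ 1≤j (sym (≈⇒≡ j<M (>-nonZero⁻¹ M) (begin
          j                         ≡⟨ *-identityʳ j ⟨
          j * 1                     ≈⟨ *-congˡ j (toℕ-reduce 1) ⟨
          j * Y g₀                  ≈⟨ toℕ-reduce _ ⟨
          Y (scale j g₀)            ≡⟨ cong Y j·g₀≡0 ⟩
          Y (zeroG n)               ≈⟨ toℕ-reduce 0 ⟩
          0                         ∎)))
        where open ≈-Reasoning
      kernel⊆ : ∀ m → E χ m ≡ 0 → ∃ λ t → t < M × scale t g₀ ≡ m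
      kernel⊆ m Em≡0 = y , FinP.toℕ<n (gy m) , G-ext (≈-trans (toℕ-reduce _) (≈-trans (*-congˡ y (toℕ-reduce c)) (≈-sym x≈yc)))
                                                       (≈-trans (toℕ-reduce _) (≈-trans (*-congˡ y (toℕ-reduce 1)) (≡⇒≈ (*-identityʳ y))))
        where
          x = X m
          y = Y m
          x≈yc : x ≈ y * c
          x≈yc = begin
            x                                   ≡⟨ *-identityʳ x ⟨
            x * 1                               ≈⟨ *-congˡ x aa⁻¹≈1 ⟨
            x * (a * a⁻¹)                       ≡⟨ +-identityʳ _ ⟨
            x * (a * a⁻¹) + 0                   ≈⟨ +-congˡ (x * (a * a⁻¹)) (≈-trans (*-congˡ y (+-negate≈0 (a⁻¹ * b))) (≡⇒≈ (*-zeroʳ y))) ⟨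
            x * (a * a⁻¹) + y * (a⁻¹ * b + c)   ≡⟨ solve 6 (λ x a a' y b c → x :* (a :* a') :+ y :* (a' :* b :+ c) := a' :* (x :* a :+ y :* b) :+ y :* c) refl x a a⁻¹ y b c ⟩
            a⁻¹ * (x * a + y * b) + y * c       ≈⟨ +-cong (*-congˡ a⁻¹ (≈-sym (E-linear χ m))) ≈-refl ⟩
            a⁻¹ * E χ m + y * c                 ≡⟨ cong (λ e → a⁻¹ * e + y * c) Em≡0 ⟩
            a⁻¹ * 0 + y * c                     ≡⟨ cong (_+ y * c) (*-zeroʳ a⁻¹) ⟩
            y * c                               ∎
            where open ≈-Reasoning

  swap : G n → G n
  swap g = ⟨ gy g , gx g ⟩

  _∘swap : Character n → Character n
  χ ∘swap = record { expo = λ g → expo χ (swap g) ; hom = λ g g' → hom χ (swap g) (swap g') }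

  cyclicKernel-swap : ∀ χ → CyclicKernel (χ ∘swap) → CyclicKernel χ
  cyclicKernel-swap χ K = record
    { generator = swap generator ; E-generator = E-generator
    ; generator-order = order ; kernel⊆multiples = kernel⊆ }
    where
      open CyclicKernel K
      order : IsOrder (swap generator) M
      order with generator-order
      ... | 1≤M , M·g≡0 , minimal = 1≤M , cong swap M·g≡0 , λ j 1≤j j<M j·g≡0 → minimal j 1≤j j<M (cong swap j·g≡0)
      kernel⊆ : ∀ m → E χ m ≡ 0 → ∃ λ t → t < M × scale t (swap generator) ≡ m
      kernel⊆ m Em≡0 with kernel⊆multiples (swap m) Em≡0
      ... | t , t<M , t·g≡m = t , t<M , cong swap t·g≡m

  cyclicKernel-e₂ : ∀ χ → Odd (E χ e₂) → CyclicKernel χ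
  cyclicKernel-e₂ χ ob = cyclicKernel-swap χ (cyclicKernel-e₁ (χ ∘swap) ob)

  ∈-orbit⇒SameOrbit : ∀ {m g : G n} → g ∈ orbit m → SameOrbit m g
  ∈-orbit⇒SameOrbit {m} g∈ with ∈-map⁻ (λ u → scale u m) (∈-deduplicate⁻ _≟G_ _ g∈)
  ... | u , u∈ , g≡u·m with ∈-filter⁻ (λ u → (u % 2) ℕ.≟ 1) {xs = upTo M} u∈
  ... | u∈upTo , ou = u , ou , ∈-upTo⁻ u∈upTo , sym g≡u·m

  SameOrbit⇒∈-orbit : ∀ {m g : G n} → SameOrbit m g → g ∈ orbit m
  SameOrbit⇒∈-orbit {m} (u , ou , u<M , refl) =
    ∈-deduplicate⁺ _≟G_ (∈-map⁺ (λ u → scale u m) (∈-filter⁺ (λ u → (u % 2) ℕ.≟ 1) (∈-upTo⁺ u<M) ou))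

  orbit-unique : ∀ (m : G n) → Unique (orbit m)
  orbit-unique m = UniqueDecP.deduplicate-! _≟G_ _

  E-∈-orbit : ∀ χ {m g} → g ∈ orbit m → ∃ λ u → Odd u × E χ g ≈ u * E χ m
  E-∈-orbit χ {m} g∈ with ∈-orbit⇒SameOrbit g∈
  ... | u , ou , _ , refl = u , ou , E-scale χ u m

  charOnOrbit-const : ∀ χ {m e} → (∀ {g} → g ∈ orbit m → E χ g ≡ e) →
    ∀ j → charOnOrbit χ m j ≡ + orbitSize m *ℤ zetaPow n e j
  charOnOrbit-const χ {m} {e} E≡e j = begin
    charOnOrbit χ m j                                     ≡⟨ cycSum-at (λ g → zetaPow n (E χ g)) (orbit m) j ⟩
    sumℤ (map (λ g → zetaPow n (E χ g) j) (orbit m))      ≡⟨ sumℤ-const (AllP.map⁺ (All.tabulate (λ g∈ → cong (λ t → zetaPow n t j) (E≡e g∈)))) ⟩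
    + length (map _ (orbit m)) *ℤ zetaPow n e j           ≡⟨ cong (λ l → + l *ℤ zetaPow n e j) (length-map _ (orbit m)) ⟩
    + orbitSize m *ℤ zetaPow n e j                        ∎
    where open ≡-Reasoning

≡ᵇ-true : ∀ {a b} → a ≡ b → (a ≡ᵇ b) ≡ true
≡ᵇ-true {a} {b} = dec-true (a ℕ.≟ b)

≡ᵇ-false : ∀ {a b} → a ≢ b → (a ≡ᵇ b) ≡ false
≡ᵇ-false {a} {b} = dec-false (a ℕ.≟ b)

module OrbitTree (k : ℕ) where

  n : ℕ
  n = suc k

  open Group n public

  h : ℕ
  h = 2 ^ k

  h>0 : h > 0
  h>0 = m^n>0 2 k

  h+h≡M : h + h ≡ M
  h+h≡M = cong (_+_ h) (sym (+-identityʳ h))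

  h<M : h < M
  h<M = subst (h <_) h+h≡M (m<m+n h h>0)

  1<M : 1 < M
  1<M = ≤-<-trans h>0 h<M

  h*odd≈h : ∀ {w} → Odd w → h * w ≈ h
  h*odd≈h {w} ow = begin
    h * w                 ≡⟨ cong (h *_) (odd⇒≡1+[/2]*2 ow) ⟩
    h * (1 + w / 2 * 2)   ≡⟨ solve 2 (λ h q → h :* (con 1 :+ q :* con 2) := h :+ q :* (con 2 :* h)) refl h (w / 2) ⟩
    h + w / 2 * M         ≈⟨ +-congˡ h (m*M≈0 (w / 2)) ⟩
    h + 0                 ≡⟨ +-identityʳ h ⟩
    h                     ∎
    where open ≈-Reasoning

  2c≈0⇒c≡h : ∀ {c} → c < M → 2 * c ≈ 0 → c ≢ 0 → c ≡ h
  2c≈0⇒c≡h {c} c<M 2c≈0 c≢0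
    with (2 * c) / M | m<n*o⇒m/o<n {2 * c} {2} {M} (*-monoʳ-< 2 c<M) | m≡m%n+[m/n]*n (2 * c) M
  ... | zero | _ | 2c≡ = ⊥-elim (c≢0 (*-cancelˡ-≡ c 0 2 (trans 2c≡ (cong (_+ 0) (≈0⇒%≡0 2c≈0)))))
  ... | suc zero | _ | 2c≡ = *-cancelˡ-≡ c h 2 (trans 2c≡ (trans (cong (_+ 1 * M) (≈0⇒%≡0 2c≈0)) (*-identityˡ M)))
  ... | suc (suc _) | s≤s (s≤s ()) | _

  odd-inverse : ∀ {u w} → u * w ≈ 1 → Odd w
  odd-inverse {u} {w} (mk≈ uw≈1) with parity w
  ... | inj₂ ow = ow
  ... | inj₁ ew = ⊥-elim (0≢1 (begin
    0                        ≡⟨ cong (_% 2) (*-zeroʳ (u % 2)) ⟨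
    (u % 2 * 0) % 2          ≡⟨ cong (λ t → (u % 2 * t) % 2) ew ⟨
    (u % 2 * (w % 2)) % 2    ≡⟨ %-distribˡ-* u w 2 ⟨
    (u * w) % 2              ≡⟨ m∣n⇒o%n%m≡o%m 2 M (u * w) (m∣m*n h) ⟨
    (u * w) % M % 2          ≡⟨ cong (_% 2) (trans uw≈1 (m<n⇒m%n≡m 1<M)) ⟩
    1                        ∎))
    where open ≡-Reasoning
          0≢1 : 0 ≢ 1
          0≢1 ()

  orbit-closed : ∀ {m} w → Odd w → ∀ {g} → g ∈ orbit m → scale w g ∈ orbit m
  orbit-closed {m} w ow g∈ with ∈-orbit⇒SameOrbit g∈
  ... | u , ou , _ , refl = SameOrbit⇒∈-orbit
    (w * u % M , odd-% M (m∣m*n h) (odd-* {w} {u} ow ou) , m%n<n _ M ,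
     trans (scale-% (w * u) m) (sym (scale-* w u m)))

  ∈-orbit-self : ∀ m → m ∈ orbit m
  ∈-orbit-self m = SameOrbit⇒∈-orbit (1 , refl , 1<M , scale-1 m)

  orbitSize≢0 : ∀ m → orbitSize m ≢ 0
  orbitSize≢0 m with orbit m | ∈-orbit-self m
  ... | _ ∷ _ | _ = λ ()

  odd-generator : ∀ χ → IsCharOrder χ M → Odd (E χ e₁) ⊎ Odd (E χ e₂)
  odd-generator χ (_ , _ , minimal) with parity (E χ e₁) | parity (E χ e₂)
  ... | inj₂ oa | _ = inj₁ oa
  ... | inj₁ _ | inj₂ ob = inj₂ ob
  ... | inj₁ ea | inj₁ eb = ⊥-elim (minimal h h>0 h<M χ^h-trivial)
    where
      a = E χ e₁
      b = E χ e₂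
      χ^h-trivial : CharPowTrivial χ h
      χ^h-trivial g = ≈0⇒%≡0 (begin
        h * E χ g                                 ≈⟨ *-congˡ h (E-linear χ g) ⟩
        h * (X g * a + Y g * b)                   ≡⟨ cong₂ (λ p q → h * (X g * p + Y g * q)) (even⇒≡[/2]*2 ea) (even⇒≡[/2]*2 eb) ⟩
        h * (X g * (a / 2 * 2) + Y g * (b / 2 * 2)) ≡⟨ solve 5 (λ h x y p q → h :* (x :* (p :* con 2) :+ y :* (q :* con 2)) := (x :* p :+ y :* q) :* (con 2 :* h)) refl h (X g) (Y g) (a / 2) (b / 2) ⟩
        (X g * (a / 2) + Y g * (b / 2)) * M        ≈⟨ m*M≈0 (X g * (a / 2) + Y g * (b / 2)) ⟩
        0                                          ∎)
        where open ≈-Reasoning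

  cyclicKernel : ∀ χ → IsCharOrder χ M → CyclicKernel χ
  cyclicKernel χ order with odd-generator χ order
  ... | inj₁ oa = cyclicKernel-e₁ χ oa
  ... | inj₂ ob = cyclicKernel-e₂ χ ob

  zetaPow-0-isInt : CycIsInt n (zetaPow n 0) (+ 1)
  zetaPow-0-isInt zero _ = refl
  zetaPow-0-isInt (suc j) _ = refl

  zetaPow-h-isInt : CycIsInt n (zetaPow n h) (- + 1)
  zetaPow-h-isInt zero _ rewrite ≡ᵇ-false (>⇒≢ h>0) | ≡ᵇ-true {h} refl = refl
  zetaPow-h-isInt (suc j) j<h
    rewrite ≡ᵇ-false (>⇒≢ j<h) | ≡ᵇ-false {h} {suc j + h} (<⇒≢ (m<n+m h z<s)) = refl

  zetaPow-+h : ∀ {r j} → r < h → j < h → zetaPow n (r + h) j ≡ - zetaPow n r j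
  zetaPow-+h {r} {j} r<h j<h
    rewrite ≡ᵇ-false {r + h} {j} (>⇒≢ (<-≤-trans j<h (m≤n+m h r)))
          | ≡ᵇ-false {r} {j + h} (<⇒≢ (<-≤-trans r<h (m≤n+m h j))) with r ℕ.≟ j
  ... | yes refl rewrite ≡ᵇ-true {r} refl | ≡ᵇ-true {r + h} refl = refl
  ... | no r≢j rewrite ≡ᵇ-false r≢j | ≡ᵇ-false {r + h} {j + h} (r≢j ∘ +-cancelʳ-≡ h r j) = refl

  zetaPow-shift : ∀ {e j} → e < M → j < h → zetaPow n ((e + h) % M) j ≡ - zetaPow n e j
  zetaPow-shift {e} {j} e<M j<h with e ℕ.<? h
  ... | yes e<h = trans (cong (λ t → zetaPow n t j) (m<n⇒m%n≡m (subst (e + h <_) h+h≡M (+-monoˡ-< h e<h))))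
                        (zetaPow-+h e<h j<h)
  ... | no e≮h = begin
    zetaPow n ((e + h) % M) j    ≡⟨ cong (λ t → zetaPow n t j) [e+h]%M≡r ⟩
    zetaPow n r j                ≡⟨ ZP.neg-involutive _ ⟨
    - - zetaPow n r j            ≡⟨ cong -_ (zetaPow-+h r<h j<h) ⟨
    - zetaPow n (r + h) j        ≡⟨ cong (λ t → - zetaPow n t j) (m∸n+n≡m h≤e) ⟩
    - zetaPow n e j              ∎
    where
      open ≡-Reasoning
      h≤e = ≮⇒≥ e≮h
      r = e ∸ h
      r<h : r < h
      r<h = m<n+o⇒m∸n<o e h {{m^n≢0 2 k}} (subst (e <_) (sym h+h≡M) e<M)
      [e+h]%M≡r : (e + h) % M ≡ r
      [e+h]%M≡r = begin
        (e + h) % M        ≡⟨ cong (λ t → (t + h) % M) (m∸n+n≡m h≤e) ⟨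
        (r + h + h) % M    ≡⟨ cong (_% M) (trans (+-assoc r h h) (cong (_+_ r) h+h≡M)) ⟩
        (r + M) % M        ≡⟨ [m+n]%n≡m%n r M ⟩
        r % M              ≡⟨ m<n⇒m%n≡m (<-trans r<h h<M) ⟩
        r                  ∎

  CycIsInt-*ℤ : ∀ {a c} l → CycIsInt n a c → CycIsInt n (λ j → + l *ℤ a j) (+ l *ℤ c)
  CycIsInt-*ℤ l isInt j j<h with j ≡ᵇ 0 | isInt j j<h
  ... | true | aj≡c = cong (+ l *ℤ_) aj≡c
  ... | false | aj≡0 = trans (cong (+ l *ℤ_) aj≡0) (ZP.*-zeroʳ (+ l))

  charOnOrbit-isInt : ∀ χ {m e c} → (∀ {g} → g ∈ orbit m → E χ g ≡ e) →
    CycIsInt n (zetaPow n e) c → CycIsInt n (charOnOrbit χ m) (+ orbitSize m *ℤ c)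
  charOnOrbit-isInt χ {m} E≡e isInt j j<h =
    trans (charOnOrbit-const χ E≡e j) (CycIsInt-*ℤ (orbitSize m) isInt j j<h)

  charOnOrbit-E≡0 : ∀ χ m → E χ m ≡ 0 → CycIsInt n (charOnOrbit χ m) (+ orbitSize m)
  charOnOrbit-E≡0 χ m Em≡0 = subst (CycIsInt n (charOnOrbit χ m)) (ZP.*-identityʳ _)
    (charOnOrbit-isInt χ E≡0 zetaPow-0-isInt)
    where
      E≡0 : ∀ {g} → g ∈ orbit m → E χ g ≡ 0
      E≡0 g∈ with E-∈-orbit χ g∈
      ... | u , _ , Eg≈uEm = ≈⇒≡ (E<M χ _) (>-nonZero⁻¹ M)
        (≈-trans Eg≈uEm (≡⇒≈ (trans (cong (u *_) Em≡0) (*-zeroʳ u))))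

  charOnOrbit-E≡h : ∀ χ m → E χ m ≡ h → CycIsInt n (charOnOrbit χ m) (- + orbitSize m)
  charOnOrbit-E≡h χ m Em≡h = subst (CycIsInt n (charOnOrbit χ m))
    (trans (ZP.*-comm _ (- + 1)) (ZP.-1*i≡-i _)) (charOnOrbit-isInt χ E≡h zetaPow-h-isInt)
    where
      E≡h : ∀ {g} → g ∈ orbit m → E χ g ≡ h
      E≡h g∈ with E-∈-orbit χ g∈
      ... | u , ou , Eg≈uEm = ≈⇒≡ (E<M χ _) h<M
        (≈-trans Eg≈uEm (≈-trans (≡⇒≈ (trans (cong (u *_) Em≡h) (*-comm u h))) (h*odd≈h ou)))

  valuation<k : ∀ {c s w} → c < M → c ≢ h → Odd w → c ≡ 2 ^ s * w → s < n → s < k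
  valuation<k {c} {s} {w} c<M c≢h ow c≡2^s*w s<n with m≤n⇒m<n∨m≡n (≤-pred s<n)
  ... | inj₁ s<k = s<k
  ... | inj₂ refl with w | ow
  ...   | suc zero | _ = ⊥-elim (c≢h (trans c≡2^s*w (*-identityʳ h)))
  ...   | suc (suc w') | _ = ⊥-elim (<⇒≱ c<M (begin
    M                   ≡⟨ *-comm 2 h ⟩
    h * 2               ≤⟨ *-monoʳ-≤ h (s≤s (s≤s z≤n)) ⟩
    h * suc (suc w')    ≡⟨ c≡2^s*w ⟨
    c                   ∎))
    where open ≤-Reasoning

  -- Multiplying by v = 1 + 2^(n-1-s) adds h to every element of 2-adic valuation s < n - 1.
  shift-multiplier : ∀ {c} → c < M → c ≢ 0 → c ≢ h →
    ∃ λ v → Odd v × (∀ u → Odd u → v * (u * c) ≈ u * c + h)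
  shift-multiplier {c} c<M c≢0 c≢h with odd-part n c c≢0 c<M
  ... | s , w , s<n , ow , c≡2^s*w = 1 + p * 2 , odd-1+2* p , shift
    where
      p = 2 ^ (k ∸ suc s)
      p*2*2^s≡h : p * 2 * 2 ^ s ≡ h
      p*2*2^s≡h = begin
        p * 2 * 2 ^ s             ≡⟨ *-assoc p 2 (2 ^ s) ⟩
        p * 2 ^ suc s             ≡⟨ ^-distribˡ-+-* 2 (k ∸ suc s) (suc s) ⟨
        2 ^ (k ∸ suc s + suc s)   ≡⟨ cong (2 ^_) (m∸n+n≡m (valuation<k c<M c≢h ow c≡2^s*w s<n)) ⟩
        h                         ∎
        where open ≡-Reasoning
      shift : ∀ u → Odd u → (1 + p * 2) * (u * c) ≈ u * c + h
      shift u ou = begin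
        (1 + p * 2) * (u * c)                  ≡⟨ cong (λ t → (1 + p * 2) * (u * t)) c≡2^s*w ⟩
        (1 + p * 2) * (u * (2 ^ s * w))        ≡⟨ solve 4 (λ p q u w → (con 1 :+ p :* con 2) :* (u :* (q :* w)) := u :* (q :* w) :+ (p :* con 2 :* q) :* (u :* w)) refl p (2 ^ s) u w ⟩
        u * (2 ^ s * w) + p * 2 * 2 ^ s * (u * w) ≡⟨ cong (λ t → u * (2 ^ s * w) + t * (u * w)) p*2*2^s≡h ⟩
        u * (2 ^ s * w) + h * (u * w)          ≈⟨ +-congˡ (u * (2 ^ s * w)) (h*odd≈h (odd-* {u} {w} ou ow)) ⟩
        u * (2 ^ s * w) + h                    ≡⟨ cong (λ t → u * t + h) c≡2^s*w ⟨
        u * c + h                              ∎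
        where open ≈-Reasoning

  charOnOrbit-vanishes : ∀ χ m → E χ m ≢ 0 → E χ m ≢ h → CycIsInt n (charOnOrbit χ m) (+ 0)
  charOnOrbit-vanishes χ m Em≢0 Em≢h j j<h with shift-multiplier (E<M χ m) Em≢0 Em≢h
  ... | v , ov , v-shifts =
    trans (cycSum-at (λ g → zetaPow n (E χ g)) L j) (trans (≡-neg⇒≡0 S≡-S) (sym (if-eta (j ≡ᵇ 0))))
    where
      L = orbit m
      f : G n → ℤ
      f g = zetaPow n (E χ g) j
      v⁻¹ = proj₁ (odd⇒invertible {v} ov)
      vv⁻¹≈1 : v * v⁻¹ ≈ 1
      vv⁻¹≈1 = proj₂ (odd⇒invertible {v} ov)
      v⁻¹v≈1 : v⁻¹ * v ≈ 1
      v⁻¹v≈1 = ≈-trans (≡⇒≈ (*-comm v⁻¹ v)) vv⁻¹≈1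
      f-shift : ∀ {g} → g ∈ L → f (scale v g) ≡ - f g
      f-shift {g} g∈ with E-∈-orbit χ g∈
      ... | u , ou , Eg≈uEm = trans (cong (λ t → zetaPow n t j) E-vg) (zetaPow-shift (E<M χ g) j<h)
        where
          E-vg : E χ (scale v g) ≡ (E χ g + h) % M
          E-vg = ≈⇒≡ (E<M χ _) (m%n<n _ M) (begin
            E χ (scale v g)     ≈⟨ E-scale χ v g ⟩
            v * E χ g           ≈⟨ *-congˡ v Eg≈uEm ⟩
            v * (u * E χ m)     ≈⟨ v-shifts u ou ⟩
            u * E χ m + h       ≈⟨ +-cong Eg≈uEm ≈-refl ⟨
            E χ g + h           ≈⟨ %-≈ _ ⟨
            (E χ g + h) % M     ∎)
            where open ≈-Reasoning
      L↭vL : L ↭ map (scale v) L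
      L↭vL = map-bijection-↭ (orbit-unique m) (orbit-closed v ov) (orbit-closed v⁻¹ (odd-inverse {v} vv⁻¹≈1))
                             (scale-inverse {v} {v⁻¹} vv⁻¹≈1) (scale-inverse {v⁻¹} {v} v⁻¹v≈1)
      S≡-S : sumℤ (map f L) ≡ - sumℤ (map f L)
      S≡-S = begin
        sumℤ (map f L)                ≡⟨ sumℤ-↭ (PermP.map⁺ f L↭vL) ⟩
        sumℤ (map f (map (scale v) L)) ≡⟨ cong sumℤ (map-∘ L) ⟨
        sumℤ (map (f ∘ scale v) L)    ≡⟨ cong sumℤ (map-cong-local (All.tabulate f-shift)) ⟩
        sumℤ (map (-_ ∘ f) L)         ≡⟨ cong sumℤ (map-∘ L) ⟩
        sumℤ (map -_ (map f L))       ≡⟨ sumℤ-map-neg (map f L) ⟩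
        - sumℤ (map f L)              ∎
        where open ≡-Reasoning

  agrees⇒E≡0 : ∀ χ g → AgreesWithChiN χ g → E χ g ≡ 0
  agrees⇒E≡0 χ g agrees with E χ g ℕ.≟ 0
  ... | yes Eg≡0 = Eg≡0
  ... | no Eg≢0 = ⊥-elim (orbitSize≢0 g (ZP.+-injective |orbit|≡0))
    where
      g∈P⁺ : InPplus g g
      g∈P⁺ = 0 , z≤n , 1 , refl , 1<M , trans (scale-1 _) (scale-1 g)
      value : charOnOrbit χ g 0 ≡ + orbitSize g
      value = proj₁ (agrees g) g∈P⁺ 0 h>0
      |orbit|≡0 : + orbitSize g ≡ + 0
      |orbit|≡0 with E χ g ℕ.≟ h
      ... | yes Eg≡h = ≡-neg⇒≡0 (trans (sym value) (charOnOrbit-E≡h χ g Eg≡h 0 h>0))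
      ... | no Eg≢h = trans (sym value) (charOnOrbit-vanishes χ g Eg≢0 Eg≢h 0 h>0)

  module Path (χ : Character n) (K : CyclicKernel χ) where

    open CyclicKernel K

    InPplus⇒E≡0 : ∀ {m} → InPplus generator m → E χ m ≡ 0
    InPplus⇒E≡0 (j , _ , u , _ , _ , refl) = ≈⇒≡ (E<M χ _) (>-nonZero⁻¹ M) (begin
      E χ (scale u (scale (2 ^ j) generator))   ≈⟨ E-scale χ u _ ⟩
      u * E χ (scale (2 ^ j) generator)         ≈⟨ *-congˡ u (E-scale χ (2 ^ j) generator) ⟩
      u * (2 ^ j * E χ generator)               ≡⟨ cong (λ e → u * (2 ^ j * e)) E-generator ⟩
      u * (2 ^ j * 0)                           ≡⟨ cong (u *_) (*-zeroʳ (2 ^ j)) ⟩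
      u * 0                                     ≡⟨ *-zeroʳ u ⟩
      0                                         ∎)
      where open ≈-Reasoning

    E≡0⇒InPplus : ∀ m → E χ m ≡ 0 → InPplus generator m
    E≡0⇒InPplus m Em≡0 with kernel⊆multiples m Em≡0
    ... | t , t<M , t·g≡m with t ℕ.≟ 0
    ...   | yes refl = n , ≤-refl , 1 , refl , 1<M ,
                       trans (scale-1 _) (trans (proj₁ (proj₂ generator-order)) t·g≡m)
    ...   | no t≢0 with odd-part n t t≢0 t<M
    ...     | s , w , s<n , ow , t≡2^s*w = s , <⇒≤ s<n , w , ow , w<M , (begin
      scale w (scale (2 ^ s) generator)   ≡⟨ scale-* w (2 ^ s) generator ⟩
      scale (w * 2 ^ s) generator         ≡⟨ cong (λ x → scale x generator) (trans (*-comm w (2 ^ s)) (sym t≡2^s*w)) ⟩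
      scale t generator                   ≡⟨ t·g≡m ⟩
      m                                   ∎)
      where
        open ≡-Reasoning
        w<M : w < M
        w<M = ≤-<-trans (subst (w ≤_) (sym t≡2^s*w) (m≤n*m w (2 ^ s) {{m^n≢0 2 s}})) t<M

    InPminus⇒E≡h : ∀ {m} → InPminus generator m → E χ m ≡ h
    InPminus⇒E≡h {m} (_ , 2m∈P⁺ , m∉P⁺) = 2c≈0⇒c≡h (E<M χ m)
      (≈-trans (≈-sym (E-scale χ 2 m)) (≡⇒≈ (InPplus⇒E≡0 2m∈P⁺))) (m∉P⁺ ∘ E≡0⇒InPplus m)

    E≡h⇒InPminus : ∀ {m} → E χ m ≡ h → ¬ InPplus generator m → InPminus generator m
    E≡h⇒InPminus {m} Em≡h m∉P⁺ = m≢0 , E≡0⇒InPplus (scale 2 m) E-2m≡0 , m∉P⁺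
      where
        m≢0 : m ≢ zeroG n
        m≢0 refl = >⇒≢ h>0 (trans (sym Em≡h) (E-zero χ))
        E-2m≡0 : E χ (scale 2 m) ≡ 0
        E-2m≡0 = ≈⇒≡ (E<M χ _) (>-nonZero⁻¹ M)
          (≈-trans (E-scale χ 2 m) (≈-trans (≡⇒≈ (cong (2 *_) Em≡h)) M≈0))

    agrees : AgreesWithChiN χ generator
    agrees m = (λ m∈P⁺ → charOnOrbit-E≡0 χ m (InPplus⇒E≡0 m∈P⁺))
             , (λ m∈P⁻ → charOnOrbit-E≡h χ m (InPminus⇒E≡h m∈P⁻))
             , (λ m∉P⁺ m∉P⁻ → charOnOrbit-vanishes χ m (m∉P⁺ ∘ E≡0⇒InPplus m)
                                                      (λ Em≡h → m∉P⁻ (E≡h⇒InPminus Em≡h m∉P⁺)))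

    agrees⇒SameOrbit : ∀ g → IsOrder g M → AgreesWithChiN χ g → SameOrbit generator g
    agrees⇒SameOrbit g (_ , _ , minimal) agrees-g with kernel⊆multiples g (agrees⇒E≡0 χ g agrees-g)
    ... | t , t<M , t·g≡g with parity t
    ...   | inj₂ ot = t , ot , t<M , t·g≡g
    ...   | inj₁ et = ⊥-elim (minimal h h>0 h<M (begin
      scale h g                   ≡⟨ cong (scale h) t·g≡g ⟨
      scale h (scale t generator) ≡⟨ scale-* h t generator ⟩
      scale (h * t) generator     ≡⟨ cong (λ x → scale x generator) h*t≡[t/2]*M ⟩
      scale (t / 2 * M) generator ≡⟨ scale-*M (t / 2) generator ⟩
      zeroG n                     ∎))
      where
        open ≡-Reasoning
        h*t≡[t/2]*M : h * t ≡ t / 2 * M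
        h*t≡[t/2]*M = trans (cong (h *_) (even⇒≡[/2]*2 et))
          (solve 2 (λ h q → h :* (q :* con 2) := q :* (con 2 :* h)) refl h (t / 2))

theorem2p4 : (n : ℕ) → 2 ≤ n → (χ : Character n) → IsCharOrder χ (2 ^ n) →
    Σ (G n) λ gN → IsOrder gN (2 ^ n) × AgreesWithChiN χ gN
      × ((g' : G n) → IsOrder g' (2 ^ n) → AgreesWithChiN χ g' → SameOrbit gN g')
theorem2p4 zero ()
theorem2p4 (suc k) _ χ order = generator , generator-order , agrees , agrees⇒SameOrbit
  where
    open OrbitTree k
    K = cyclicKernel χ order
    open CyclicKernel K
    open Path χ K
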